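{- Let $G$ be a strictly chordal graph and let $S$ be a minimal vertex separator of $G$. Then all vertices of $S$ are pairwise true twins, i.e. $N[u]=N[v]$ for all $u,v\in S$.
   Context: All graphs are finite and simple. $N[v]=N(v)\cup\{v\}$ is the closed neighborhood of $v$. A block graph is a connected graph in which every block (maximal biconnected subgraph) is a clique. Two vertices $u,v$ are true twins if $N[u]=N[v]$. A strictly chordal graph (block duplicate graph) is a graph obtained from a block graph by adding zero or more true twins to its vertices (i.e. replacing each vertex by a set of pairwise true twin vertices). For non-adjacent vertices $u,v$, a set $S\subset V$ is a $uv$-separator if $u$ and $v$ lie in different connected components of $G-S$; it is a minimal $uv$-separator if no proper subset is a $uv$-separator. A minimal vertex separator is a set that is a minimal $uv$-separator for some pair of non-adjacent vertices $u,v$. -}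

module Defs where

open import Data.Nat using (ℕ)
open import Data.Fin using (Fin)
open import Data.Fin.Subset using (Subset; _∈_; _∉_; _⊂_; ∁; _-_)
open import Data.Bool using (Bool; true)
open import Data.Product using (Σ; ∃; ∃-syntax; _×_)
open import Data.Sum using (_⊎_)
open import Relation.Nullary using (¬_)
open import Relation.Binary.PropositionalEquality using (_≡_; _≢_)
open import Function.Bundles using (_⇔_)

record Graph (n : ℕ) : Set where
  field
    E     : Fin n → Fin n → Bool
    sym   : ∀ u v → E u v ≡ E v u
    irrefl : ∀ u → ¬ (E u u ≡ true)

module _ {n : ℕ} (G : Graph n) where
  open Graph G

  Adj : Fin n → Fin n → Set
  Adj u v = E u v ≡ true

  data PathIn (X : Subset n) : Fin n → Fin n → Set where
    here : ∀ {u} → u ∈ X → PathIn X u u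
    step : ∀ {u w v} → u ∈ X → Adj u w → PathIn X w v → PathIn X u v

  -- G[X] is connected (vacuously true for X empty).
  ConnectedOn : Subset n → Set
  ConnectedOn X = ∀ u v → u ∈ X → v ∈ X → PathIn X u v

  Connected : Set
  Connected = ∀ (u v : Fin n) → PathIn (Data.Fin.Subset.⊤) u v

  InClosedNbhd : Fin n → Fin n → Set
  InClosedNbhd v w = (w ≡ v) ⊎ Adj v w

  TrueTwins : Fin n → Fin n → Set
  TrueTwins u v = ∀ w → InClosedNbhd u w ⇔ InClosedNbhd v w

  Clique : Subset n → Set
  Clique B = ∀ u v → u ∈ B → v ∈ B → u ≢ v → Adj u v

  NonSeparable : Subset n → Set
  NonSeparable B = ConnectedOn B × (∀ x → x ∈ B → ConnectedOn (B - x))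

  Block : Subset n → Set
  Block B = (∃[ x ] x ∈ B) × NonSeparable B × (∀ B′ → B ⊂ B′ → ¬ NonSeparable B′)

  Separator : Subset n → Fin n → Fin n → Set
  Separator S u v = u ∉ S × v ∉ S × ¬ PathIn (∁ S) u v

  MinimalSeparator : Subset n → Fin n → Fin n → Set
  MinimalSeparator S u v =
    Separator S u v × (∀ T → T ⊂ S → ¬ Separator T u v)

  MinimalVertexSeparator : Subset n → Set
  MinimalVertexSeparator S =
    ∃[ u ] ∃[ v ] (u ≢ v × ¬ Adj u v × MinimalSeparator S u v)

BlockGraph : ∀ {m} → Graph m → Set
BlockGraph H = Connected H × (∀ B → Block H B → Clique H B)

-- Strictly chordal (block duplicate) graph: obtained from a block graph H
-- by replacing each vertex x of H by a nonempty set f⁻¹(x) of pairwise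
-- true twins.
StrictlyChordal : ∀ {n} → Graph n → Set
StrictlyChordal {n} G =
  ∃[ m ] Σ (Graph m) λ H → Σ (Fin n → Fin m) λ f →
    BlockGraph H
    × (∀ y → ∃[ x ] f x ≡ y)
    × (∀ u v → Adj G u v ⇔ (u ≢ v × (f u ≡ f v ⊎ Adj H (f u) (f v))))

module Submission where

-- G arises from a block graph H by a map f whose fibres are twin classes, so it suffices to show
-- that all vertices of a minimal uv-separator S have the same image.  By minimality every s ∈ S
-- has neighbours a and b in the components of u and v in G − S, and for t ∈ S there is a u–v
-- path avoiding S − t.  If f s ≠ f t, then a ⇝ u ⇝ v ⇝ b along that path maps to a walk in H
-- from f a to f b missing f s; with the edges at f s it closes a cycle, which lies in a block,
-- i.e. in a clique.  So f a and f b are equal or adjacent, hence so are a and b, joining the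
-- two components of G − S.

open import Defs
open import Data.Nat using (ℕ)
open import Data.Fin using (Fin; _≟_)
open import Data.Fin.Subset using (Subset; _∈_; _∉_; _⊆_; _⊂_; _⊃_; ∁; _─_; _-_; _∪_; ⁅_⁆; outside)
  renaming (⊥ to ∅)
open import Data.Fin.Subset.Properties
  using (x∈⁅x⁆; x∈⁅y⁆⇒x≡y; ∉⊥; x∈p∪q⁺; x∈p∪q⁻; x∉p⇒x∈∁p; x∈∁p⇒x∉p; p⊆q⇒∁p⊇∁q;
         p─q⊆p; x∈p∧x≢y⇒x∈p-y; x∈p⇒p-x⊂p)
open import Data.Fin.Subset.Induction using (Acc; acc; ⊃-wellFounded)
open import Data.Vec using (_∷_; here; there)
open import Data.List using (List; []; _∷_)
open import Data.List.Relation.Unary.Any using (here; there)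
open import Data.List.Relation.Unary.All using ([])
open import Data.List.Relation.Unary.All.Properties using (¬Any⇒All¬; All¬⇒¬Any)
open import Data.List.Relation.Unary.Unique.Propositional using (Unique; []; _∷_)
open import Data.List.Relation.Binary.Subset.Propositional.Properties using (∷⁺ʳ)
import Data.List.Membership.Propositional as List
import Data.List.Relation.Binary.Subset.Propositional as List
open import Data.Product using (∃; ∃₂; ∃-syntax; _×_; _,_; proj₁; proj₂)
open import Data.Sum using (_⊎_; inj₁; inj₂; map₁)
open import Data.Empty using (⊥; ⊥-elim)
open import Function using (_∘_; id)
open import Function.Bundles using (_⇔_; mk⇔; Equivalence)
open import Function.Construct.Symmetry using (⇔-sym)
open import Function.Construct.Composition using (_⇔-∘_)
open import Relation.Nullary using (¬_; yes; no)
open import Relation.Nullary.Decidable using (decidable-stable)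
open import Relation.Binary.PropositionalEquality using (_≡_; _≢_; refl; sym; trans; subst)

private
  variable
    n : ℕ

x∈p─q⇒x∉q : {x : Fin n} {p q : Subset n} → x ∈ p ─ q → x ∉ q
x∈p─q⇒x∉q {p = _ ∷ _} {outside ∷ _} here ()
x∈p─q⇒x∉q {p = _ ∷ _} {_ ∷ _} (there x∈p─q) (there x∈q) = x∈p─q⇒x∉q x∈p─q x∈q

x∈p-y⇒x≢y : {x y : Fin n} {p : Subset n} → x ∈ p - y → x ≢ y
x∈p-y⇒x≢y x∈p-y refl = x∈p─q⇒x∉q x∈p-y (x∈⁅x⁆ _)

∁p⊆∁[p-y] : {p : Subset n} {y : Fin n} → ∁ p ⊆ ∁ (p - y)
∁p⊆∁[p-y] {p = p} {y} = p⊆q⇒∁p⊇∁q (p─q⊆p p ⁅ y ⁆)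

x∈∁[p-y]∧x≢y⇒x∈∁p : {x y : Fin n} {p : Subset n} → x ∈ ∁ (p - y) → x ≢ y → x ∈ ∁ p
x∈∁[p-y]∧x≢y⇒x∈∁p x∈ x≢y = x∉p⇒x∈∁p (λ x∈p → x∈∁p⇒x∉p x∈ (x∈p∧x≢y⇒x∈p-y x∈p x≢y))

vertices : List (Fin n) → Subset n
vertices []       = ∅
vertices (x ∷ xs) = ⁅ x ⁆ ∪ vertices xs

∈vertices⁺ : {z : Fin n} {xs : List (Fin n)} → z List.∈ xs → z ∈ vertices xs
∈vertices⁺ (here refl)  = x∈p∪q⁺ (inj₁ (x∈⁅x⁆ _))
∈vertices⁺ (there z∈xs) = x∈p∪q⁺ (inj₂ (∈vertices⁺ z∈xs))

∈vertices⁻ : {z : Fin n} (xs : List (Fin n)) → z ∈ vertices xs → z List.∈ xs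
∈vertices⁻ []       z∈⊥ = ⊥-elim (∉⊥ z∈⊥)
∈vertices⁻ (x ∷ xs) z∈  with x∈p∪q⁻ ⁅ x ⁆ (vertices xs) z∈
... | inj₁ z∈⁅x⁆ = here (x∈⁅y⁆⇒x≡y x z∈⁅x⁆)
... | inj₂ z∈xs  = there (∈vertices⁻ xs z∈xs)

module Paths {n : ℕ} (G : Graph n) where

  adj-sym : ∀ {u v} → Adj G u v → Adj G v u
  adj-sym {u} {v} = trans (Graph.sym G v u)

  closedNbhd-sym : ∀ {u v} → InClosedNbhd G u v → InClosedNbhd G v u
  closedNbhd-sym (inj₁ refl) = inj₁ refl
  closedNbhd-sym (inj₂ u~v)  = inj₂ (adj-sym u~v)

  source∈ : ∀ {X u v} → PathIn G X u v → u ∈ X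
  source∈ (here u∈X)     = u∈X
  source∈ (step u∈X _ _) = u∈X

  target∈ : ∀ {X u v} → PathIn G X u v → v ∈ X
  target∈ (here v∈X)   = v∈X
  target∈ (step _ _ P) = target∈ P

  infixr 5 _++ₚ_
  _++ₚ_ : ∀ {X u v w} → PathIn G X u v → PathIn G X v w → PathIn G X u w
  here _       ++ₚ Q = Q
  step u∈ a P  ++ₚ Q = step u∈ a (P ++ₚ Q)

  extendₚ : ∀ {X u v w} → PathIn G X u v → InClosedNbhd G v w → w ∈ X → PathIn G X u w
  extendₚ P (inj₁ refl) _   = P
  extendₚ P (inj₂ v~w)  w∈X = P ++ₚ step (target∈ P) v~w (here w∈X)

  reverseₚ : ∀ {X u v} → PathIn G X u v → PathIn G X v u
  reverseₚ (here u∈X)     = here u∈X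
  reverseₚ (step u∈X u~w P) = extendₚ (reverseₚ P) (inj₂ (adj-sym u~w)) u∈X

  weakenₚ : ∀ {X Y u v} → X ⊆ Y → PathIn G X u v → PathIn G Y u v
  weakenₚ X⊆Y (here u∈X)       = here (X⊆Y u∈X)
  weakenₚ X⊆Y (step u∈X u~w P) = step (X⊆Y u∈X) u~w (weakenₚ X⊆Y P)

  hub⇒connectedOn : ∀ {X} r → (∀ a → a ∈ X → PathIn G X a r) → ConnectedOn G X
  hub⇒connectedOn r reach a b a∈X b∈X = reach a a∈X ++ₚ reverseₚ (reach b b∈X)

module Separators {n : ℕ} (G : Graph n) where
  open Paths G

  minimal⇒¬¬pathAvoiding : ∀ {S u v s} → MinimalSeparator G S u v → s ∈ S →
                           ¬ ¬ PathIn G (∁ (S - s)) u v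
  minimal⇒¬¬pathAvoiding {S} {s = s} ((u∉S , v∉S , _) , minimal) s∈S noPath =
    minimal (S - s) (x∈p⇒p-x⊂p s∈S)
      (u∉S ∘ p─q⊆p S ⁅ s ⁆ , v∉S ∘ p─q⊆p S ⁅ s ⁆ , noPath)

  crossingNeighbour : ∀ {S s a b} → PathIn G (∁ (S - s)) a b → a ∉ S → ¬ PathIn G (∁ S) a b →
                      ∃[ c ] PathIn G (∁ S) a c × Adj G c s
  crossingNeighbour (here _) a∉S noPath = ⊥-elim (noPath (here (x∉p⇒x∈∁p a∉S)))
  crossingNeighbour {s = s} (step {w = w} _ a~w P) a∉S noPath with w ≟ s
  ... | yes refl = _ , here (x∉p⇒x∈∁p a∉S) , a~w
  ... | no w≢s
    with crossingNeighbour P (x∈∁p⇒x∉p (x∈∁[p-y]∧x≢y⇒x∈∁p (source∈ P) w≢s))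
                             (noPath ∘ step (x∉p⇒x∈∁p a∉S) a~w)
  ...   | c , Q , c~s = c , step (x∉p⇒x∈∁p a∉S) a~w Q , c~s

  minimal⇒¬¬fullNeighbours :
    ∀ {S u v s} → MinimalSeparator G S u v → s ∈ S →
    ¬ ¬ (∃₂ λ a b → PathIn G (∁ S) u a × PathIn G (∁ S) v b × Adj G a s × Adj G b s)
  minimal⇒¬¬fullNeighbours min@((u∉S , v∉S , noPath) , _) s∈S k =
    minimal⇒¬¬pathAvoiding min s∈S λ P →
      let a , Pa , a~s = crossingNeighbour P u∉S noPath
          b , Pb , b~s = crossingNeighbour (reverseₚ P) v∉S (noPath ∘ reverseₚ)
      in  k (a , b , Pa , Pb , a~s , b~s)

module Walks {n : ℕ} (H : Graph n) where
  open Paths H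
  open import Data.List.Membership.DecPropositional (_≟_ {n}) using () renaming (_∈?_ to _∈ˡ?_)

  data Walk : Fin n → Fin n → List (Fin n) → Set where
    done : ∀ {u} → Walk u u (u ∷ [])
    edge : ∀ {u w v vs} → Adj H u w → Walk w v vs → Walk u v (u ∷ vs)

  walk-source∈ : ∀ {u v vs} → Walk u v vs → u List.∈ vs
  walk-source∈ done       = here refl
  walk-source∈ (edge _ _) = here refl

  walk-target∈ : ∀ {u v vs} → Walk u v vs → v List.∈ vs
  walk-target∈ done       = here refl
  walk-target∈ (edge _ W) = there (walk-target∈ W)

  walk⇒path : ∀ {X u v vs} → Walk u v vs → (∀ {z} → z List.∈ vs → z ∈ X) → PathIn H X u v
  walk⇒path done       vs⊆X = here (vs⊆X (here refl))
  walk⇒path (edge a W) vs⊆X = step (vs⊆X (here refl)) a (walk⇒path W (vs⊆X ∘ there))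

  record SplitAt (vs : List (Fin n)) (p q a : Fin n) : Set where
    field
      before after   : List (Fin n)
      toA            : Walk p a before
      fromA          : Walk a q after
      before⊆        : before List.⊆ vs
      after⊆         : after List.⊆ vs
      after-unique   : Unique after
      meet-only-at-a : ∀ {y} → y List.∈ before → y List.∈ after → y ≡ a

  split : ∀ {p q a vs} → Unique vs → Walk p q vs → a List.∈ vs → SplitAt vs p q a
  split vs! done (here refl) = record
    { toA = done ; fromA = done ; before⊆ = id ; after⊆ = id
    ; after-unique = vs! ; meet-only-at-a = λ { (here refl) _ → refl } }
  split vs! (edge p~w W) (here refl) = record
    { toA = done ; fromA = edge p~w W ; before⊆ = λ { (here refl) → here refl } ; after⊆ = id
    ; after-unique = vs! ; meet-only-at-a = λ { (here refl) _ → refl } }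
  split (p∉vs ∷ vs!) (edge p~w W) (there a∈vs) = record
    { toA = edge p~w toA ; fromA = fromA ; before⊆ = ∷⁺ʳ _ before⊆ ; after⊆ = there ∘ after⊆
    ; after-unique = after-unique
    ; meet-only-at-a = λ { (here refl) y∈after → ⊥-elim (All¬⇒¬Any p∉vs (after⊆ y∈after))
                         ; (there y∈before) y∈after → meet-only-at-a y∈before y∈after } }
    where open SplitAt (split vs! W a∈vs)

  shortcut : ∀ {p q vs} → Walk p q vs → ∃[ ws ] Walk p q ws × Unique ws × ws List.⊆ vs
  shortcut done = _ , done , [] ∷ [] , id
  shortcut {p} (edge p~w W) with shortcut W
  ... | ws , W′ , ws! , ws⊆vs with p ∈ˡ? ws
  ...   | no p∉ws  = p ∷ ws , edge p~w W′ , ¬Any⇒All¬ ws p∉ws ∷ ws! , ∷⁺ʳ p ws⊆vs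
  ...   | yes p∈ws = after , fromA , after-unique , there ∘ ws⊆vs ∘ after⊆
    where s = split ws! W′ p∈ws
          open SplitAt s

  cycle-nonSeparable : ∀ {x p q vs} → Walk p q vs → Unique vs → x List.∉ vs →
                       Adj H x p → Adj H x q → NonSeparable H (vertices (x ∷ vs))
  cycle-nonSeparable {x} {p} {q} {vs} W vs! x∉vs x~p x~q =
    hub⇒connectedOn x reachInC , connectedWithout
    where
    C : Subset n
    C = vertices (x ∷ vs)

    x∈C : x ∈ C
    x∈C = ∈vertices⁺ {xs = x ∷ vs} (here refl)

    onCycle⇒∈C-y : ∀ {y z} → z List.∈ vs → z ≢ y → z ∈ C - y
    onCycle⇒∈C-y z∈vs = x∈p∧x≢y⇒x∈p-y (∈vertices⁺ (there z∈vs))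

    avoiding⇒∈C-y : ∀ {y ws z} → ws List.⊆ vs → y List.∉ ws → z List.∈ ws → z ∈ C - y
    avoiding⇒∈C-y ws⊆vs y∉ws z∈ws = onCycle⇒∈C-y (ws⊆vs z∈ws) λ { refl → y∉ws z∈ws }

    module _ {c} (s : SplitAt vs p q c) where
      open SplitAt s

      viaAfter : ∀ {X} → (∀ {z} → z List.∈ after → z ∈ X) → x ∈ X → PathIn H X c x
      viaAfter after⊆X = extendₚ (walk⇒path fromA after⊆X) (inj₂ (adj-sym x~q))

      toApex : PathIn H C c x
      toApex = viaAfter (λ z∈after → ∈vertices⁺ (there (after⊆ z∈after))) x∈C

      toEndAvoidingApex : PathIn H (C - x) c q
      toEndAvoidingApex = walk⇒path fromA (avoiding⇒∈C-y after⊆ (x∉vs ∘ after⊆))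

      -- Since the path is simple, y lies on at most one side of c; go round the other way.
      toApexAvoiding : ∀ {y} → c ≢ y → x ∈ C - y → PathIn H (C - y) c x
      toApexAvoiding {y} c≢y x∈C-y with y ∈ˡ? after
      ... | no y∉after  = viaAfter (avoiding⇒∈C-y after⊆ y∉after) x∈C-y
      ... | yes y∈after =
        extendₚ (reverseₚ (walk⇒path toA (avoiding⇒∈C-y before⊆ y∉before)))
                (inj₂ (adj-sym x~p)) x∈C-y
        where
        y∉before : y List.∉ before
        y∉before y∈before = c≢y (sym (meet-only-at-a y∈before y∈after))

    reachInC : ∀ c → c ∈ C → PathIn H C c x
    reachInC c c∈C with ∈vertices⁻ (x ∷ vs) c∈C
    ... | here refl  = here x∈C
    ... | there c∈vs = toApex (split vs! W c∈vs)

    connectedWithout : ∀ y → y ∈ C → ConnectedOn H (C - y)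
    connectedWithout y y∈C with ∈vertices⁻ (x ∷ vs) y∈C
    ... | here refl = hub⇒connectedOn q reach
      where
      reach : ∀ c → c ∈ C - x → PathIn H (C - x) c q
      reach c c∈ with ∈vertices⁻ (x ∷ vs) (p─q⊆p C ⁅ x ⁆ c∈)
      ... | here refl  = ⊥-elim (x∈p-y⇒x≢y c∈ refl)
      ... | there c∈vs = toEndAvoidingApex (split vs! W c∈vs)
    ... | there y∈vs = hub⇒connectedOn x reach
      where
      x∈C-y : x ∈ C - y
      x∈C-y = x∈p∧x≢y⇒x∈p-y x∈C λ { refl → x∉vs y∈vs }

      reach : ∀ c → c ∈ C - y → PathIn H (C - y) c x
      reach c c∈ with ∈vertices⁻ (x ∷ vs) (p─q⊆p C ⁅ y ⁆ c∈)
      ... | here refl  = here x∈C-y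
      ... | there c∈vs = toApexAvoiding (split vs! W c∈vs) (x∈p-y⇒x≢y c∈) x∈C-y

module Blocks {n : ℕ} (H : Graph n) where
  open Walks H

  -- Maximality of a non-separable set is not decidable here, so the block is only obtained under ¬ ¬.
  nonSeparable⇒¬¬inBlock : ∀ X → ∃ (_∈ X) → NonSeparable H X → ¬ ¬ (∃[ B ] Block H B × X ⊆ B)
  nonSeparable⇒¬¬inBlock X = go (⊃-wellFounded X)
    where
    go : ∀ {X} → Acc _⊃_ X → ∃ (_∈ X) → NonSeparable H X → ¬ ¬ (∃[ B ] Block H B × X ⊆ B)
    go {X} (acc larger) (z , z∈X) X-ns noBlock = noBlock (X , ((z , z∈X) , X-ns , maximal) , id)
      where
      maximal : ∀ Y → X ⊂ Y → ¬ NonSeparable H Y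
      maximal Y X⊂Y@(X⊆Y , _) Y-ns = go (larger X⊂Y) (z , X⊆Y z∈X) Y-ns
        λ (B , B-block , Y⊆B) → noBlock (B , B-block , Y⊆B ∘ X⊆Y)

  avoidingWalk⇒¬¬closedNbhd : (∀ B → Block H B → Clique H B) →
                       ∀ {x p q vs} → InClosedNbhd H x p → InClosedNbhd H x q →
                       Walk p q vs → x List.∉ vs → ¬ ¬ InClosedNbhd H p q
  avoidingWalk⇒¬¬closedNbhd _ (inj₁ refl) _ W x∉vs = ⊥-elim (x∉vs (walk-source∈ W))
  avoidingWalk⇒¬¬closedNbhd _ _ (inj₁ refl) W x∉vs = ⊥-elim (x∉vs (walk-target∈ W))
  avoidingWalk⇒¬¬closedNbhd cliques {x} {p} {q} (inj₂ x~p) (inj₂ x~q) W x∉vs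
    with q ≟ p | shortcut W
  ... | yes q≡p | _ = λ k → k (inj₁ q≡p)
  ... | no q≢p  | ws , W′ , ws! , ws⊆vs = λ k →
    nonSeparable⇒¬¬inBlock C (x , ∈vertices⁺ {xs = x ∷ ws} (here refl))
      (cycle-nonSeparable W′ ws! (x∉vs ∘ ws⊆vs) x~p x~q)
      λ (B , B-block , C⊆B) → k (inj₂ (cliques B B-block p q
        (C⊆B (∈vertices⁺ (there (walk-source∈ W′))))
        (C⊆B (∈vertices⁺ (there (walk-target∈ W′))))
        (q≢p ∘ sym)))
    where
    C : Subset n
    C = vertices (x ∷ ws)

module BlowUp {n m : ℕ} (G : Graph n) (H : Graph m) (f : Fin n → Fin m)
  (adj⇔ : ∀ u v → Adj G u v ⇔ (u ≢ v × (f u ≡ f v ⊎ Adj H (f u) (f v)))) where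

  open Paths G
  open Separators G
  open Walks H
  open Blocks H

  closedNbhd⇔image : ∀ u w → InClosedNbhd G u w ⇔ InClosedNbhd H (f u) (f w)
  closedNbhd⇔image u w = mk⇔ to from
    where
    to : InClosedNbhd G u w → InClosedNbhd H (f u) (f w)
    to (inj₁ refl) = inj₁ refl
    to (inj₂ u~w) with proj₂ (Equivalence.to (adj⇔ u w) u~w)
    ... | inj₁ fu≡fw = inj₁ (sym fu≡fw)
    ... | inj₂ fu~fw = inj₂ fu~fw

    from : InClosedNbhd H (f u) (f w) → InClosedNbhd G u w
    from fu≈fw with w ≟ u
    ... | yes w≡u = inj₁ w≡u
    ... | no w≢u  = inj₂ (Equivalence.from (adj⇔ u w) (w≢u ∘ sym , map₁ sym fu≈fw))

  sameImage⇒TrueTwins : ∀ {s t} → f s ≡ f t → TrueTwins G s t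
  sameImage⇒TrueTwins {s} {t} fs≡ft w =
    ⇔-sym (closedNbhd⇔image t w) ⇔-∘
    subst (λ c → InClosedNbhd G s w ⇔ InClosedNbhd H c (f w)) fs≡ft (closedNbhd⇔image s w)

  imageWalk : ∀ {X a b x} → PathIn G X a b → (∀ {g} → g ∈ X → f g ≢ x) →
              ∃[ vs ] Walk (f a) (f b) vs × x List.∉ vs
  imageWalk (here a∈X) avoid = _ , done , λ { (here refl) → avoid a∈X refl }
  imageWalk {b = b} (step {w = w} a∈X a~w P) avoid
    with imageWalk P avoid | Equivalence.to (closedNbhd⇔image _ w) (inj₂ a~w)
  ... | vs , W , x∉vs | inj₁ fw≡fa = vs , subst (λ c → Walk c (f b) vs) fw≡fa W , x∉vs
  ... | vs , W , x∉vs | inj₂ fa~fw =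
    _ , edge fa~fw W , λ { (here refl) → avoid a∈X refl ; (there x∈vs) → x∉vs x∈vs }

  module _ (cliques : ∀ B → Block H B → Clique H B) {S u v} (min : MinimalSeparator G S u v) where

    separated : ∀ {a b} → PathIn G (∁ S) u a → PathIn G (∁ S) v b → ¬ InClosedNbhd G a b
    separated Pa Pb a≈b = noPath (extendₚ Pa a≈b (target∈ Pb) ++ₚ reverseₚ Pb)
      where noPath = proj₂ (proj₂ (proj₁ min))

    fullNeighbours⇒sameImage :
      ∀ {s t a b} → PathIn G (∁ S) u a → PathIn G (∁ S) v b → Adj G a s → Adj G b s →
      PathIn G (∁ (S - t)) u v → ¬ f s ≢ f t
    fullNeighbours⇒sameImage {s} {t} {a} {b} Pa Pb a~s b~s Pt fs≢ft =
      let _ , W , fs∉vs = imageWalk Pab avoid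
      in  avoidingWalk⇒¬¬closedNbhd cliques (image s≈a) (image s≈b) W fs∉vs
            (separated Pa Pb ∘ Equivalence.from (closedNbhd⇔image a b))
      where
      s≈a : InClosedNbhd G s a
      s≈a = inj₂ (adj-sym a~s)

      s≈b : InClosedNbhd G s b
      s≈b = inj₂ (adj-sym b~s)

      image : ∀ {w} → InClosedNbhd G s w → InClosedNbhd H (f s) (f w)
      image {w} = Equivalence.to (closedNbhd⇔image s w)

      -- A vertex outside S with the image of s would be a twin of s, hence a common neighbour of a and b.
      avoid : ∀ {g} → g ∈ ∁ (S - t) → f g ≢ f s
      avoid {g} g∈ fg≡fs with g ≟ t
      ... | yes refl = fs≢ft (sym fg≡fs)
      ... | no g≢t   =
        separated (extendₚ Pa (closedNbhd-sym (twin s≈a)) (x∈∁[p-y]∧x≢y⇒x∈∁p g∈ g≢t)) Pb (twin s≈b)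
        where
        twin : ∀ {w} → InClosedNbhd G s w → InClosedNbhd G g w
        twin {w} = Equivalence.to (sameImage⇒TrueTwins (sym fg≡fs) w)

      Pab : PathIn G (∁ (S - t)) a b
      Pab = reverseₚ (weakenₚ ∁p⊆∁[p-y] Pa) ++ₚ Pt ++ₚ weakenₚ ∁p⊆∁[p-y] Pb

    minimalSeparator-sameImage : ∀ {s t} → s ∈ S → t ∈ S → ¬ f s ≢ f t
    minimalSeparator-sameImage s∈S t∈S fs≢ft =
      minimal⇒¬¬fullNeighbours min s∈S λ (_ , _ , Pa , Pb , a~s , b~s) →
      minimal⇒¬¬pathAvoiding min t∈S λ Pt →
      fullNeighbours⇒sameImage Pa Pb a~s b~s Pt fs≢ft

mainTheorem2 : ∀ {n} (G : Graph n) → StrictlyChordal G →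
    ∀ (S : Subset n) → MinimalVertexSeparator G S →
    ∀ u v → u ∈ S → v ∈ S → TrueTwins G u v
mainTheorem2 G (_ , H , f , (_ , cliques) , _ , adj⇔) S (_ , _ , _ , _ , min) s t s∈S t∈S =
  sameImage⇒TrueTwins (decidable-stable (f s ≟ f t) (minimalSeparator-sameImage cliques min s∈S t∈S))
  where open BlowUp G H f adj⇔
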